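{- Let $t\ge 1$, let $G=(V,E)$ be a graph with threshold functions $f_1,f_2\colon V\to\mathbb{N}$, and suppose there exist sets $P_a^0,P_b^0\subseteq V$ such that the activation process in $G$ started from these sets takes at least $t$ rounds, i.e., $P_a^t\cup P_b^t\neq P_a^{t-1}\cup P_b^{t-1}$. Then $\operatorname{td}(G)\ge\log_3(t+2)$.
   Context: The activation process: for $i\ge 0$ and $c\in\{a,b\}$ (with $\neg c$ the other element of $\{a,b\}$), $P_c^{i+1}=\{v\in V\setminus(P_a^i\cup P_b^i) : |P_c^i\cap N(v)|\ge f_1(v)\}\cup\{v\in P_{\neg c}^i : |P_c^i\cap N(v)|\ge f_2(v)\}\cup P_c^i$, where $N(v)$ is the set of neighbours of $v$. The treedepth $\operatorname{td}(G)$ is $1$ if $G$ has a single vertex, $1+\min_{v\in V(G)}\operatorname{td}(G-v)$ if $G$ is connected, and otherwise the maximum treedepth of the connected components of $G$. -}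

module Defs where

open import Data.Nat using (ℕ; zero; suc; _≤ᵇ_; _≡ᵇ_; _⊔_; _⊓_)
open import Data.Bool using (Bool; true; false; _∧_; _∨_; not; if_then_else_)
open import Data.Fin using (Fin; _≟_)
open import Data.List using (List; []; _∷_; map; foldr; allFin; filterᵇ)
open import Data.Nat.ListAction using (sum)
open import Data.Bool.ListAction using (any)
open import Data.Product using (_×_; _,_; proj₁; proj₂)
open import Relation.Nullary.Decidable using (⌊_⌋)

-- A graph on vertex set Fin n, given by a Boolean adjacency relation.
-- (Symmetry and irreflexivity are imposed as hypotheses in the statement.)
Graph : ℕ → Set
Graph n = Fin n → Fin n → Bool

VSet : ℕ → Set
VSet n = Fin n → Bool

module _ {n : ℕ} where

  members : VSet n → List (Fin n)
  members S = filterᵇ S (allFin n)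

  count : VSet n → ℕ
  count S = sum (map (λ i → if S i then 1 else 0) (allFin n))

  nbCount : Graph n → VSet n → Fin n → ℕ
  nbCount E X v = count (λ u → X u ∧ E v u)

  remove : VSet n → Fin n → VSet n
  remove S v u = S u ∧ not ⌊ u ≟ v ⌋

  iter : ℕ → (VSet n → VSet n) → VSet n → VSet n
  iter zero    g R = R
  iter (suc k) g R = iter k g (g R)

  reachStep : Graph n → VSet n → VSet n → VSet n
  reachStep E S R u = R u ∨ (S u ∧ any (λ w → R w ∧ E w u) (allFin n))

  -- vertex set of the connected component of G[S] containing v (for v ∈ S):
  -- all vertices reachable from v within S (paths of length < n suffice)
  component : Graph n → VSet n → Fin n → VSet n
  component E S v = iter n (reachStep E S) (λ u → ⌊ u ≟ v ⌋)

  maxL : List ℕ → ℕ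
  maxL = foldr _⊔_ 0

  minL : List ℕ → ℕ
  minL []       = 0
  minL (x ∷ xs) = foldr _⊓_ x xs

  -- td(G[S]) computed with fuel (fuel ≥ |S| suffices since every recursive
  -- call is on a strictly smaller vertex set):
  --  * single vertex: 1
  --  * connected: 1 + min_{v ∈ S} td(G[S] - v)
  --  * disconnected: max over the components (the component of each v ∈ S)
  -- The empty graph gets value 0 (not covered by the paper's definition).
  tdAux : Graph n → ℕ → VSet n → ℕ
  tdAux E zero    S = 0
  tdAux E (suc f) S with members S
  ... | []    = 0
  ... | v ∷ _ =
    if count (component E S v) ≡ᵇ count S
    then (if count S ≡ᵇ 1 then 1
          else suc (minL (map (λ u → tdAux E f (remove S u)) (members S))))
    else maxL (map (λ u → tdAux E f (component E S u)) (members S))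

  td : Graph n → ℕ
  td E = tdAux E n (λ _ → true)

  -- The activation process.
  -- nextP E f₁ f₂ Pc Pnc : P_c^{i+1} from P_c^i = Pc and P_{¬c}^i = Pnc
  nextP : Graph n → (Fin n → ℕ) → (Fin n → ℕ) → VSet n → VSet n → VSet n
  nextP E f₁ f₂ Pc Pnc v =
    (not (Pc v ∨ Pnc v) ∧ (f₁ v ≤ᵇ nbCount E Pc v))
    ∨ (Pnc v ∧ (f₂ v ≤ᵇ nbCount E Pc v))
    ∨ Pc v

  process : Graph n → (Fin n → ℕ) → (Fin n → ℕ) → VSet n → VSet n → ℕ → VSet n × VSet n
  process E f₁ f₂ Pa Pb zero = Pa , Pb
  process E f₁ f₂ Pa Pb (suc i) =
    let P = process E f₁ f₂ Pa Pb i
    in nextP E f₁ f₂ (proj₁ P) (proj₂ P) , nextP E f₁ f₂ (proj₂ P) (proj₁ P)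

  activeAt : Graph n → (Fin n → ℕ) → (Fin n → ℕ) → VSet n → VSet n → ℕ → VSet n
  activeAt E f₁ f₂ Pa Pb i v =
    proj₁ (process E f₁ f₂ Pa Pb i) v ∨ proj₂ (process E f₁ f₂ Pa Pb i) v

{-# OPTIONS --safe #-}
-- A vertex's state (membership in P_a and in P_b) only grows, so it changes at most twice, and a
-- vertex that changes in round m+1 but not in round m has a neighbour that changed in round m.
-- Call S frozen on a window of rounds if no vertex outside S adjacent to S changes during it.
-- Along the recursive definition of treedepth, changes inside a frozen S die out within
-- 3^td(G[S]) rounds: components of G[S] do not interact, and if td(G[S] - r) = d, the at most two
-- changes of r cut the window into at most three windows in which S - r is frozen, each of at
-- most 3^d rounds. A vertex activated in round t still had both changes left, whence t + 2 ≤ 3^td(G).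
module Submission where

open import Defs
open import Data.Nat using (ℕ; zero; suc; _⊔_; _⊓_; _≤_; _<_; _+_; _*_; _∸_; _^_; z≤n; s≤s; z<s; _≡ᵇ_; _≤ᵇ_)
open import Data.Nat.Properties hiding (_≟_)
open import Data.Bool as Bool using (Bool; true; false; _∧_; _∨_; not; if_then_else_; T; f≤t; b≤b)
import Data.Bool.Properties as BoolP
open BoolP using (T-≡; T-∧; ∨-zeroʳ; ∧-zeroʳ; ∧-identityʳ; ∧-conicalˡ; ∧-conicalʳ; ¬-not)
open import Data.Fin using (Fin; _≟_)
open import Data.Fin.Properties using (¬∀⟶∃¬; all?)
open import Data.List using (List; []; _∷_; map; allFin; length)
open import Data.List.Properties using (length-tabulate)
open import Data.Nat.ListAction using (sum)
open import Data.List.Membership.Propositional using (_∈_; lose)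
open import Data.List.Membership.Propositional.Properties using (∈-allFin; ∈-filter⁺; ∈-filter⁻; ∈-map⁺; ∈-map⁻)
open import Data.List.Relation.Unary.Any using (here; there; satisfied)
open import Data.List.Relation.Unary.Any.Properties using (any⁺; any⁻)
open import Data.Product using (_×_; _,_; proj₁; proj₂; ∃-syntax)
open import Data.Product.Properties using (≡-dec)
open import Data.Sum using (_⊎_; inj₁; inj₂; [_,_]′)
open import Data.Empty using (⊥-elim)
open import Function.Bundles using (Equivalence)
open import Relation.Binary.PropositionalEquality
open import Relation.Nullary using (¬_; Dec; yes; no; _→-dec_; contradiction)
open import Relation.Binary.Definitions using (DecidableEquality)
open import Relation.Nullary.Decidable using (⌊_⌋; decidable-stable)

open Equivalence using (to; from)

module _ {A : Set} where

  sum-map-mono : (xs : List A) {f g : A → ℕ} → (∀ x → f x ≤ g x) → sum (map f xs) ≤ sum (map g xs)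
  sum-map-mono []       f≤g = z≤n
  sum-map-mono (x ∷ xs) f≤g = +-mono-≤ (f≤g x) (sum-map-mono xs f≤g)

  sum-map-mono-< : {xs : List A} {f g : A → ℕ} → (∀ x → f x ≤ g x) →
                   ∀ {y} → y ∈ xs → f y < g y → sum (map f xs) < sum (map g xs)
  sum-map-mono-< {x ∷ xs} f≤g (here refl) fx<gx = +-mono-<-≤ fx<gx (sum-map-mono xs f≤g)
  sum-map-mono-< {x ∷ xs} f≤g (there y∈xs) fy<gy = +-mono-≤-< (f≤g x) (sum-map-mono-< f≤g y∈xs fy<gy)

  sum-map-≤-length : (xs : List A) {f : A → ℕ} → (∀ x → f x ≤ 1) → sum (map f xs) ≤ length xs
  sum-map-≤-length []       f≤1 = z≤n
  sum-map-≤-length (x ∷ xs) f≤1 = +-mono-≤ (f≤1 x) (sum-map-≤-length xs f≤1)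

indicator : Bool → ℕ
indicator b = if b then 1 else 0

indicator-mono : ∀ {a b} → (a ≡ true → b ≡ true) → indicator a ≤ indicator b
indicator-mono {false} _   = z≤n
indicator-mono {true}  a⇒b rewrite a⇒b refl = ≤-refl

indicator-≤1 : ∀ b → indicator b ≤ 1
indicator-≤1 false = z≤n
indicator-≤1 true  = ≤-refl

≡ᵇ≡false⇒≢ : ∀ {m n} → (m ≡ᵇ n) ≡ false → m ≢ n
≡ᵇ≡false⇒≢ {m} eq refl = subst T eq (≡⇒≡ᵇ m m refl)

≡ᵇ≡true⇒≡ : ∀ {m n} → (m ≡ᵇ n) ≡ true → m ≡ n
≡ᵇ≡true⇒≡ {m} {n} eq = ≡ᵇ⇒≡ m n (T-≡ .from eq)

¬[≡true⇒] : ∀ {b} {A : Set} → ¬ (b ≡ true → A) → b ≡ true × ¬ A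
¬[≡true⇒] {false} h = ⊥-elim (h (λ ()))
¬[≡true⇒] {true}  h = refl , λ a → h (λ _ → a)

⌊≟⌋-refl : ∀ {n} (v : Fin n) → ⌊ v ≟ v ⌋ ≡ true
⌊≟⌋-refl v with v ≟ v
... | yes _  = refl
... | no v≢v = ⊥-elim (v≢v refl)

⌊≟⌋-sound : ∀ {n} {u v : Fin n} → ⌊ u ≟ v ⌋ ≡ true → u ≡ v
⌊≟⌋-sound {u = u} {v} eq with u ≟ v
... | yes u≡v = u≡v

module _ {n : ℕ} where

  _⊆_ : VSet n → VSet n → Set
  S ⊆ T = ∀ u → S u ≡ true → T u ≡ true

  full : VSet n
  full _ = true

  count-mono : {S T : VSet n} → S ⊆ T → count S ≤ count T
  count-mono S⊆T = sum-map-mono (allFin n) (λ u → indicator-mono (S⊆T u))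

  count-mono-< : {S T : VSet n} → S ⊆ T → ∀ {u} → S u ≡ false → T u ≡ true → count S < count T
  count-mono-< {S} {T} S⊆T {u} Su Tu =
    sum-map-mono-< (λ x → indicator-mono (S⊆T x)) (∈-allFin u)
                   (subst₂ (λ a b → indicator a < indicator b) (sym Su) (sym Tu) ≤-refl)

  count-cong : {S T : VSet n} → (∀ u → S u ≡ T u) → count S ≡ count T
  count-cong S≗T = ≤-antisym (count-mono (λ u → trans (sym (S≗T u)))) (count-mono (λ u → trans (S≗T u)))

  count≤n : (S : VSet n) → count S ≤ n
  count≤n S = subst (count S ≤_) (length-tabulate (λ u → u)) (sum-map-≤-length (allFin n) (λ u → indicator-≤1 (S u)))

  count-≥⇒⊇ : {S T : VSet n} → S ⊆ T → count T ≤ count S → T ⊆ S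
  count-≥⇒⊇ {S} S⊆T T≤S u Tu with S u in Su
  ... | true  = refl
  ... | false = ⊥-elim (<⇒≱ (count-mono-< S⊆T Su Tu) T≤S)

  count≥n⇒full : {S : VSet n} → n ≤ count S → full ⊆ S
  count≥n⇒full {S} n≤S = count-≥⇒⊇ (λ _ _ → refl) (≤-trans (count≤n full) n≤S)

  count≤0⇒∅ : {S : VSet n} → count S ≤ 0 → ∀ u → S u ≡ false
  count≤0⇒∅ {S} S≤0 u with S u in Su
  ... | false = refl
  ... | true  = ⊥-elim (<⇒≱ (count-mono-< {λ _ → false} (λ _ ()) refl Su) (≤-trans S≤0 z≤n))

  ∈-members⁺ : {S : VSet n} {u : Fin n} → S u ≡ true → u ∈ members S
  ∈-members⁺ {S} {u} Su = ∈-filter⁺ (λ x → Bool.T? (S x)) (∈-allFin u) (T-≡ .from Su)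

  ∈-members⁻ : {S : VSet n} {u : Fin n} → u ∈ members S → S u ≡ true
  ∈-members⁻ {S} u∈ = T-≡ .to (proj₂ (∈-filter⁻ (λ x → Bool.T? (S x)) {xs = allFin n} u∈))

  members≡[]⇒∅ : {S : VSet n} → members S ≡ [] → ∀ u → S u ≡ false
  members≡[]⇒∅ {S} eq u with S u in Su
  ... | false = refl
  ... | true  with subst (u ∈_) eq (∈-members⁺ Su)
  ... | ()

  members≡∷⇒∈ : {S : VSet n} {v : Fin n} {vs : List (Fin n)} → members S ≡ v ∷ vs → S v ≡ true
  members≡∷⇒∈ eq = ∈-members⁻ (subst (_ ∈_) (sym eq) (here refl))

  maxL-≥ : ∀ {x xs} → x ∈ xs → x ≤ maxL {n} xs
  maxL-≥ {xs = y ∷ xs} (here refl)  = m≤m⊔n y (maxL {n} xs)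
  maxL-≥ {xs = y ∷ xs} (there x∈xs) = ≤-trans (maxL-≥ x∈xs) (m≤n⊔m y (maxL {n} xs))

  minL-∈ : ∀ x xs → minL {n} (x ∷ xs) ∈ x ∷ xs
  minL-∈ x []       = here refl
  minL-∈ x (y ∷ xs) with ⊓-sel y (minL {n} (x ∷ xs)) | minL-∈ x xs
  ... | inj₁ min≡y  | _              = there (here min≡y)
  ... | inj₂ min≡ys | here min≡x     = here (trans min≡ys min≡x)
  ... | inj₂ min≡ys | there min∈xs   = there (there (subst (_∈ xs) (sym min≡ys) min∈xs))

  minL-map-attained : {A : Set} (h : A → ℕ) {xs : List A} {x : A} {ys : List A} → xs ≡ x ∷ ys →
                      ∃[ u ] u ∈ xs × minL {n} (map h xs) ≡ h u
  minL-map-attained h {x = x} {ys} refl = ∈-map⁻ h (minL-∈ (h x) (map h ys))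

  remove-⊆ : (S : VSet n) (r : Fin n) → remove S r ⊆ S
  remove-⊆ S r u = ∧-conicalˡ (S u) _

  remove-∌ : (S : VSet n) (r : Fin n) → remove S r r ≡ false
  remove-∌ S r rewrite ⌊≟⌋-refl r = ∧-zeroʳ (S r)

  remove-keeps : {S : VSet n} {r x : Fin n} → S x ≡ true → x ≢ r → remove S r x ≡ true
  remove-keeps {S} {r} {x} Sx x≢r with x ≟ r
  ... | yes x≡r = ⊥-elim (x≢r x≡r)
  ... | no _    rewrite Sx = refl

  count-remove-< : {S : VSet n} {r : Fin n} → S r ≡ true → count (remove S r) < count S
  count-remove-< {S} {r} Sr = count-mono-< (remove-⊆ S r) (remove-∌ S r) Sr

module Reachability {n : ℕ} (E : Graph n) where

  Closed : VSet n → VSet n → Set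
  Closed S D = ∀ w y → D w ≡ true → E w y ≡ true → S y ≡ true → D y ≡ true

  closed-⊆⊇ : ∀ {S D D′} → Closed S D → D′ ⊆ D → D ⊆ D′ → Closed S D′
  closed-⊆⊇ closed D′⊆D D⊆D′ w y D′w Ewy Sy = D⊆D′ y (closed w y (D′⊆D w D′w) Ewy Sy)

  reachStep-⊇ : ∀ S R → R ⊆ reachStep E S R
  reachStep-⊇ S R u Ru rewrite Ru = refl

  iter-⊇ : ∀ S k R → R ⊆ iter k (reachStep E S) R
  iter-⊇ S zero    R = λ _ Ru → Ru
  iter-⊇ S (suc k) R u Ru = iter-⊇ S k (reachStep E S R) u (reachStep-⊇ S R u Ru)

  reachStep-⊆ : ∀ {S D} R → Closed S D → R ⊆ D → reachStep E S R ⊆ D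
  reachStep-⊆ {S} R closed R⊆D u stepRu with R u in Ru
  ... | true  = R⊆D u Ru
  ... | false with satisfied (any⁻ _ (allFin n) (T-≡ .from (∧-conicalʳ (S u) _ stepRu)))
  ... | w , RwEwu with T-∧ .to RwEwu
  ... | Rw , Ewu = closed w u (R⊆D w (T-≡ .to Rw)) (T-≡ .to Ewu) (∧-conicalˡ (S u) _ stepRu)

  iter-⊆ : ∀ {S D} k R → Closed S D → R ⊆ D → iter k (reachStep E S) R ⊆ D
  iter-⊆ zero    R closed R⊆D = R⊆D
  iter-⊆ (suc k) R closed R⊆D = iter-⊆ k _ closed (reachStep-⊆ R closed R⊆D)

  reachStep-⊆⇒closed : ∀ {S} R → reachStep E S R ⊆ R → Closed S R
  reachStep-⊆⇒closed {S} R step⊆R w y Rw Ewy Sy = step⊆R y stepRy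
    where
    stepRy : reachStep E S R y ≡ true
    stepRy = trans (cong₂ (λ s a → R y ∨ (s ∧ a)) Sy
                          (T-≡ .to (any⁺ _ (lose (∈-allFin w) (T-∧ .from (T-≡ .from Rw , T-≡ .from Ewy))))))
                   (∨-zeroʳ (R y))

  reachStep-⊆? : ∀ S R u → Dec (reachStep E S R u ≡ true → R u ≡ true)
  reachStep-⊆? S R u = (reachStep E S R u Bool.≟ true) →-dec (R u Bool.≟ true)

  -- Each step that is not yet closed adds a vertex, and there are only n of them.
  iter-closed : ∀ S k R → n ≤ k + count R → Closed S (iter k (reachStep E S) R)
  iter-closed S zero    R n≤R w y _ _ _ = count≥n⇒full n≤R y refl
  iter-closed S (suc k) R n≤k+R with all? (reachStep-⊆? S R)
  ... | yes step⊆R =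
    closed-⊆⊇ (reachStep-⊆⇒closed R step⊆R)
              (iter-⊆ k _ (reachStep-⊆⇒closed R step⊆R) step⊆R)
              (λ u Ru → iter-⊇ S k _ u (reachStep-⊇ S R u Ru))
  ... | no step⊈R with ¬[≡true⇒] (proj₂ (¬∀⟶∃¬ n _ (reachStep-⊆? S R) step⊈R))
  ... | stepRu , ¬Ru =
    iter-closed S k (reachStep E S R) (≤-trans n≤k+R (+-monoʳ-< k (count-mono-< (reachStep-⊇ S R) (¬-not ¬Ru) stepRu)))

  component-∋ : ∀ S v → component E S v v ≡ true
  component-∋ S v = iter-⊇ S n _ v (⌊≟⌋-refl v)

  component-closed : ∀ S v → Closed S (component E S v)
  component-closed S v = iter-closed S n _ (m≤m+n n _)

  component-least : ∀ {S D} v → Closed S D → D v ≡ true → component E S v ⊆ D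
  component-least {D = D} v closed Dv =
    iter-⊆ n _ closed λ u u≡v → subst (λ x → D x ≡ true) (sym (⌊≟⌋-sound u≡v)) Dv

  component-⊆ : ∀ {S} v → S v ≡ true → component E S v ⊆ S
  component-⊆ v Sv = component-least v (λ _ _ _ _ Sy → Sy) Sv

  component-trans : ∀ S {x y} → component E S y x ≡ true → component E S x ⊆ component E S y
  component-trans S {x} {y} = component-least x (component-closed S y)

  module _ (E-sym : ∀ u v → E u v ≡ E v u) where

    -- D, the set of x ∈ S whose component contains u, is closed: by symmetry an edge w y puts w into the component of y.
    component-sym : ∀ S {u v} → S u ≡ true → component E S u v ≡ true → component E S v u ≡ true
    component-sym S {u} {v} Su u⇝v = ∧-conicalʳ (S v) _ (component-least u closed Du v u⇝v)
      where
      D : VSet n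
      D x = S x ∧ component E S x u
      closed : Closed S D
      closed w y Dw Ewy Sy rewrite Sy =
        component-trans S (component-closed S y y w (component-∋ S y) (trans (E-sym y w) Ewy) (∧-conicalˡ (S w) _ Dw))
                        u (∧-conicalʳ (S w) _ Dw)
      Du : D u ≡ true
      Du rewrite Su = component-∋ S u

    component-proper : ∀ S {u v} → S u ≡ true → S v ≡ true → count (component E S v) ≢ count S →
                       count (component E S u) < count S
    component-proper S {u} {v} Su Sv v-partial = ≤∧≢⇒< (count-mono (component-⊆ u Su)) u-partial
      where
      u-partial : count (component E S u) ≢ count S
      u-partial u-full = v-partial (≤-antisym (count-mono (component-⊆ v Sv)) (begin
        count S                   ≡⟨ sym u-full ⟩
        count (component E S u)   ≤⟨ count-mono (component-trans S (component-sym S Su (S⊆u v Sv))) ⟩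
        count (component E S v)   ∎))
        where
        open ≤-Reasoning
        S⊆u : S ⊆ component E S u
        S⊆u = count-≥⇒⊇ (component-⊆ u Su) (≤-reflexive (sym u-full))

_≟²_ : DecidableEquality (Bool × Bool)
_≟²_ = ≡-dec Bool._≟_ Bool._≟_

-- budget (v ∈ P_a , v ∈ P_b) counts the unset coordinates, hence bounds the changes still to come.
unset : Bool → ℕ
unset b = if b then 0 else 1

budget : Bool × Bool → ℕ
budget (a , b) = unset a + unset b

unset-antitone : ∀ {a a′} → a Bool.≤ a′ → unset a′ ≤ unset a
unset-antitone f≤t = z≤n
unset-antitone b≤b = ≤-refl

budget≤2 : ∀ s → budget s ≤ 2
budget≤2 (a , b) = +-mono-≤ (unset-antitone (BoolP.≤-minimum a)) (unset-antitone (BoolP.≤-minimum b))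

budget-< : ∀ {a b a′ b′} → a Bool.≤ a′ → b Bool.≤ b′ → (a′ , b′) ≢ (a , b) →
           budget (a′ , b′) < budget (a , b)
budget-< f≤t     b≤b′ _  = s≤s (unset-antitone b≤b′)
budget-< {a} b≤b f≤t  _  = +-monoʳ-< (unset a) z<s
budget-< b≤b     b≤b  ne = ⊥-elim (ne refl)

∨-changes⇒budget≡2 : ∀ {a b a′ b′} → a Bool.≤ a′ → b Bool.≤ b′ → a′ ∨ b′ ≢ a ∨ b →
                     budget (a , b) ≡ 2
∨-changes⇒budget≡2 {false} {false}      _   _   _  = refl
∨-changes⇒budget≡2 {true}               b≤b _   ne = ⊥-elim (ne refl)
∨-changes⇒budget≡2 {false} {true} {a′}  _   b≤b ne = ⊥-elim (ne (∨-zeroʳ a′))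

module _ {n : ℕ} (E : Graph n) (f₁ f₂ : Fin n → ℕ) where

  nextP-grows : ∀ X Y v → X v Bool.≤ nextP E f₁ f₂ X Y v
  nextP-grows X Y v with X v
  ... | false = BoolP.≤-minimum _
  ... | true  = subst (true Bool.≤_) (sym (∨-zeroʳ (Y v ∧ (f₂ v ≤ᵇ nbCount E X v)))) b≤b

  nbCount-local : ∀ X X′ v → (∀ y → E v y ≡ true → X y ≡ X′ y) → nbCount E X v ≡ nbCount E X′ v
  nbCount-local X X′ v X≗X′ = count-cong pointwise
    where
    pointwise : ∀ u → (X u ∧ E v u) ≡ (X′ u ∧ E v u)
    pointwise u with E v u in Evu
    ... | false = trans (∧-zeroʳ (X u)) (sym (∧-zeroʳ (X′ u)))
    ... | true  = cong (_∧ true) (X≗X′ u Evu)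

  nextP-local : ∀ X Y X′ Y′ v → X v ≡ X′ v → Y v ≡ Y′ v → (∀ y → E v y ≡ true → X y ≡ X′ y) →
                nextP E f₁ f₂ X Y v ≡ nextP E f₁ f₂ X′ Y′ v
  nextP-local X Y X′ Y′ v Xv Yv X≗X′ rewrite Xv | Yv | nbCount-local X X′ v X≗X′ = refl

module Activation {n : ℕ} (E : Graph n) (f₁ f₂ : Fin n → ℕ) (Pa Pb : VSet n) where

  open Reachability E

  pa pb : ℕ → VSet n
  pa i = proj₁ (process E f₁ f₂ Pa Pb i)
  pb i = proj₂ (process E f₁ f₂ Pa Pb i)

  state : ℕ → Fin n → Bool × Bool
  state i v = pa i v , pb i v

  Changes : ℕ → Fin n → Set
  Changes i v = state (suc i) v ≢ state i v

  stays : ∀ {i v} → ¬ Changes i v → state (suc i) v ≡ state i v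
  stays {i} {v} = decidable-stable (state (suc i) v ≟² state i v)

  changes⇒budget-< : ∀ {i v} → Changes i v → budget (state (suc i) v) < budget (state i v)
  changes⇒budget-< {i} {v} = budget-< (nextP-grows E f₁ f₂ (pa i) (pb i) v) (nextP-grows E f₁ f₂ (pb i) (pa i) v)

  changes⇒budget>0 : ∀ {i v} → Changes i v → 0 < budget (state i v)
  changes⇒budget>0 {i} {v} ch = ≤-<-trans z≤n (changes⇒budget-< {i} {v} ch)

  activation⇒changes : ∀ {i v} → activeAt E f₁ f₂ Pa Pb (suc i) v ≢ activeAt E f₁ f₂ Pa Pb i v → Changes i v
  activation⇒changes activates same = activates (cong (λ (a , b) → a ∨ b) same)

  activation⇒budget≡2 : ∀ {i v} → activeAt E f₁ f₂ Pa Pb (suc i) v ≢ activeAt E f₁ f₂ Pa Pb i v →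
                        budget (state i v) ≡ 2
  activation⇒budget≡2 {i} {v} =
    ∨-changes⇒budget≡2 (nextP-grows E f₁ f₂ (pa i) (pb i) v) (nextP-grows E f₁ f₂ (pb i) (pa i) v)

  state-local : ∀ {m v} → state (suc m) v ≡ state m v → (∀ y → E v y ≡ true → state (suc m) y ≡ state m y) →
                state (suc (suc m)) v ≡ state (suc m) v
  state-local {m} {v} same same-nbs = cong₂ _,_
    (nextP-local E f₁ f₂ (pa (suc m)) (pb (suc m)) (pa m) (pb m) v
                 (cong proj₁ same) (cong proj₂ same) (λ y Evy → cong proj₁ (same-nbs y Evy)))
    (nextP-local E f₁ f₂ (pb (suc m)) (pa (suc m)) (pb m) (pa m) v
                 (cong proj₂ same) (cong proj₁ same) (λ y Evy → cong proj₂ (same-nbs y Evy)))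

  neighbour-changed : ∀ {m v} → Changes (suc m) v → ¬ Changes m v → ∃[ y ] E v y ≡ true × Changes m y
  neighbour-changed {m} {v} ch ¬ch =
    let y , ¬quiet = ¬∀⟶∃¬ n _ (λ y → (E v y Bool.≟ true) →-dec (state (suc m) y ≟² state m y))
                               (λ quiet → ch (state-local {m} (stays {m} ¬ch) quiet))
    in y , ¬[≡true⇒] ¬quiet

  record Steady (a j : ℕ) (v : Fin n) : Set where
    constructor steady
    field unchanged : ∀ i → i < j → ¬ Changes (a + i) v
  open Steady

  steady-≤ : ∀ {a i j v} → i ≤ j → Steady a j v → Steady a i v
  steady-≤ i≤j st = steady λ i′ i′<i → unchanged st i′ (<-≤-trans i′<i i≤j)

  steady-shift : ∀ {a} i {j v} → Steady a (i + j) v → Steady (a + i) j v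
  steady-shift {a} i {v = v} st = steady λ i′ i′<j →
    subst (λ m → ¬ Changes m v) (sym (+-assoc a i i′)) (unchanged st (i + i′) (+-monoʳ-< i i′<j))

  steady-state : ∀ {a} j {v} → Steady a j v → state (a + j) v ≡ state a v
  steady-state {a} zero    {v} _  = cong (λ m → state m v) (+-identityʳ a)
  steady-state {a} (suc j) {v} st = begin
    state (a + suc j) v     ≡⟨ cong (λ m → state m v) (+-suc a j) ⟩
    state (suc (a + j)) v   ≡⟨ stays {a + j} (unchanged st j (n<1+n j)) ⟩
    state (a + j) v         ≡⟨ steady-state j (steady-≤ (n≤1+n j) st) ⟩
    state a v               ∎
    where open ≡-Reasoning

  first-change : ∀ a j v → Steady a j v ⊎ ∃[ i ] i < j × Changes (a + i) v × Steady a i v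
  first-change a zero    v = inj₁ (steady λ _ ())
  first-change a (suc j) v with first-change a j v
  ... | inj₂ (i , i<j , ch , st) = inj₂ (i , m<n⇒m<1+n i<j , ch , st)
  ... | inj₁ st with state (suc (a + j)) v ≟² state (a + j) v
  ...   | no ch     = inj₂ (j , n<1+n j , ch , st)
  ...   | yes same  = inj₁ (steady λ i i<1+j → [ unchanged st i , (λ { refl ch → ch same }) ]′ (m<1+n⇒m<n∨m≡n i<1+j))

  Frozen : VSet n → ℕ → ℕ → Set
  Frozen S a j = ∀ u w → S u ≡ false → S w ≡ true → E w u ≡ true → Steady a j u

  frozen-≤ : ∀ {S a i j} → i ≤ j → Frozen S a j → Frozen S a i
  frozen-≤ i≤j frozen u w Su Sw Ewu = steady-≤ i≤j (frozen u w Su Sw Ewu)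

  frozen-shift : ∀ {S a} i {j} → Frozen S a (i + j) → Frozen S (a + i) j
  frozen-shift {a = a} i frozen u w Su Sw Ewu = steady-shift {a} i (frozen u w Su Sw Ewu)

  frozen-remove : ∀ {S a j r} → Frozen S a j → Steady a j r → Frozen (remove S r) a j
  frozen-remove {S} {r = r} frozen r-steady u w S-r-u S-r-w Ewu with u ≟ r
  ... | yes refl = r-steady
  ... | no _     = frozen u w (trans (sym (∧-identityʳ (S u))) S-r-u) (remove-⊆ S r w S-r-w) Ewu

  frozen-component : ∀ {S a j} x → S x ≡ true → Frozen S a j → Frozen (component E S x) a j
  frozen-component {S} x Sx frozen u w Cu Cw Ewu with S u in Su
  ... | false = frozen u w Su (component-⊆ x Sx w Cw) Ewu
  ... | true  = contradiction (trans (sym Cu) (component-closed S x w u Cw Ewu Su)) λ ()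

  -- suc j counts the rounds of the window up to the change of x. Adding the number of changes x has
  -- left makes the bound additive when the window is cut at the changes of a single vertex.
  Settles : VSet n → ℕ → Set
  Settles S d = ∀ a j x → S x ≡ true → Frozen S a j → Changes (a + j) x → suc j + budget (state (a + j) x) ≤ 3 ^ d

  settles-∅ : ∀ {S} d → (∀ u → S u ≡ false) → Settles S d
  settles-∅ d ∅ a j x Sx = contradiction (trans (sym (∅ x)) Sx) λ ()

  -- A first change of r needs a changing neighbour one round earlier, and that neighbour lies in S - r.
  first-change-bound : ∀ {S r d a} j → Settles (remove S r) d → S r ≡ true → Frozen S a j →
                       Steady a j r → Changes (a + j) r → suc j ≤ 3 ^ d
  first-change-bound {d = d} zero _ _ _ _ _ = m^n>0 3 d
  first-change-bound {S} {r} {d} {a} (suc j) settles Sr frozen r-steady ch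
    with neighbour-changed {a + j} (subst (λ m → Changes m r) (+-suc a j) ch) (unchanged r-steady j (n<1+n j))
  ... | y , Ery , y-ch with S y in Sy
  ...   | false = contradiction y-ch (unchanged (frozen y r Sy Sr Ery) j (n<1+n j))
  ...   | true with y ≟ r
  ...     | yes refl = contradiction y-ch (unchanged r-steady j (n<1+n j))
  ...     | no y≢r   = ≤-trans (m<m+n (suc j) (changes⇒budget>0 {a + j} y-ch))
      (settles a j y (remove-keeps {S = S} Sy y≢r)
                     (frozen-remove (frozen-≤ (n≤1+n j) frozen) (steady-≤ (n≤1+n j) r-steady)) y-ch)

  settles-split : ∀ {S r d} → Settles (remove S r) d → S r ≡ true →
                  ∀ k a j x → budget (state a r) ≤ k → S x ≡ true → Frozen S a j → Changes (a + j) x →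
                  suc j + budget (state (a + j) x) ≤ suc k * 3 ^ d
  settles-split {S} {r} {d} settles Sr k a j x budget≤k Sx frozen ch with first-change a j r
  ... | inj₁ r-steady with x ≟ r
  ...   | no x≢r = ≤-trans (settles a j x (remove-keeps {S = S} Sx x≢r) (frozen-remove frozen r-steady) ch) (m≤m+n (3 ^ d) _)
  ...   | yes refl = begin
    suc j + budget (state (a + j) x)   ≡⟨ cong (λ s → suc j + budget s) (steady-state j r-steady) ⟩
    suc j + budget (state a x)         ≤⟨ +-mono-≤ (first-change-bound {d = d} j settles Sr frozen r-steady ch)
                                                    (≤-trans budget≤k (m≤m*n k (3 ^ d) {{m^n≢0 3 d}})) ⟩
    3 ^ d + k * 3 ^ d                  ∎
    where open ≤-Reasoning
  settles-split {S} {r} {d} settles Sr zero a j x budget≤k Sx frozen ch | inj₂ (i , _ , r-ch , r-steady) =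
    contradiction (subst (λ s → 0 < budget s) (steady-state i r-steady) (changes⇒budget>0 {a + i} r-ch)) (≤⇒≯ budget≤k)
  settles-split {S} {r} {d} settles Sr (suc k) a j x budget≤k Sx frozen ch | inj₂ (i , i<j , r-ch , r-steady)
    with m≤n⇒∃[o]m+o≡n i<j
  ... | j′ , refl = begin
    suc (suc i + j′) + budget (state (a + (suc i + j′)) x)   ≡⟨ regroup ⟩
    suc i + (suc j′ + budget (state (a + (suc i + j′)) x))   ≤⟨ +-mono-≤ r-bound rest ⟩
    3 ^ d + suc k * 3 ^ d                                    ∎
    where
    open ≤-Reasoning
    budget≤k′ : budget (state (a + suc i) r) ≤ k
    budget≤k′ = ≤-pred (begin-strict
      budget (state (a + suc i) r)     ≡⟨ cong (λ m → budget (state m r)) (+-suc a i) ⟩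
      budget (state (suc (a + i)) r)   <⟨ changes⇒budget-< {a + i} r-ch ⟩
      budget (state (a + i) r)         ≡⟨ cong budget (steady-state i r-steady) ⟩
      budget (state a r)               ≤⟨ budget≤k ⟩
      suc k                            ∎)
    r-bound : suc i ≤ 3 ^ d
    r-bound = first-change-bound {d = d} i settles Sr (frozen-≤ (<⇒≤ i<j) frozen) r-steady r-ch
    rest : suc j′ + budget (state (a + (suc i + j′)) x) ≤ suc k * 3 ^ d
    rest = subst (λ m → suc j′ + budget (state m x) ≤ suc k * 3 ^ d) (+-assoc a (suc i) j′)
             (settles-split {d = d} settles Sr k (a + suc i) j′ x budget≤k′ Sx (frozen-shift (suc i) frozen)
                            (subst (λ m → Changes m x) (sym (+-assoc a (suc i) j′)) ch))
    regroup : ∀ {b} → suc (suc i + j′) + b ≡ suc i + (suc j′ + b)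
    regroup {b} = cong suc (trans (cong suc (+-assoc i j′ b)) (sym (+-suc i (j′ + b))))

  settles-remove : ∀ {S r d} → S r ≡ true → Settles (remove S r) d → Settles S (suc d)
  settles-remove {r = r} {d} Sr settles a j x = settles-split {d = d} settles Sr 2 a j x (budget≤2 (state a r))

  settles-components : ∀ {S d} (g : Fin n → ℕ) → (∀ u → S u ≡ true → Settles (component E S u) (g u)) →
                       (∀ u → S u ≡ true → g u ≤ d) → Settles S d
  settles-components g settles g≤d a j x Sx frozen ch =
    ≤-trans (settles x Sx a j x (component-∋ _ x) (frozen-component x Sx frozen) ch) (^-monoʳ-≤ 3 (g≤d x Sx))

  module _ (E-sym : ∀ u v → E u v ≡ E v u) where

    settles-tdAux : ∀ f S → count S ≤ f → Settles S (tdAux E f S)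
    settles-tdAux zero    S S≤0   = settles-∅ 0 (count≤0⇒∅ S≤0)
    settles-tdAux (suc f) S S≤1+f with members S in members≡
    ... | []     = settles-∅ 0 (members≡[]⇒∅ members≡)
    ... | v ∷ vs with count (component E S v) ≡ᵇ count S in connected
    ...   | false = settles-components {d = maxL {n} (map tdC (members S))} tdC
                      (λ u Su → settles-tdAux f (component E S u) (component-fuel Su))
                      (λ u Su → maxL-≥ {n} (∈-map⁺ tdC (∈-members⁺ {S = S} Su)))
      where
      tdC : Fin n → ℕ
      tdC u = tdAux E f (component E S u)
      component-fuel : ∀ {u} → S u ≡ true → count (component E S u) ≤ f
      component-fuel Su =
        ≤-pred (≤-trans (component-proper E-sym S Su (members≡∷⇒∈ members≡) (≡ᵇ≡false⇒≢ connected)) S≤1+f)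
    ...   | true with count S ≡ᵇ 1 in singleton
    ...     | true  = settles-remove {d = 0} Sv (settles-∅ 0 (count≤0⇒∅ (≤-pred rest<1)))
      where
      Sv : S v ≡ true
      Sv = members≡∷⇒∈ members≡
      rest<1 : count (remove S v) < 1
      rest<1 = subst (count (remove S v) <_) (≡ᵇ≡true⇒≡ singleton) (count-remove-< {S = S} Sv)
    ...     | false with minL-map-attained {n} (λ u → tdAux E f (remove S u)) members≡
    ...       | u , u∈ , min≡ = subst (λ d → Settles S (suc d)) (sym min≡)
                                  (settles-remove {d = tdAux E f (remove S u)} Su (settles-tdAux f (remove S u) rest-fuel))
      where
      Su : S u ≡ true
      Su = ∈-members⁻ u∈
      rest-fuel : count (remove S u) ≤ f
      rest-fuel = ≤-pred (≤-trans (count-remove-< {S = S} Su) S≤1+f)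

lemma4 : (n : ℕ) (E : Graph n)
           → (∀ u v → E u v ≡ E v u)
           → (∀ v → E v v ≡ false)
           → (f₁ f₂ : Fin n → ℕ)
           → (t : ℕ) → 1 ≤ t
           → (Pa Pb : VSet n)
           → ¬ (∀ v → activeAt E f₁ f₂ Pa Pb t v ≡ activeAt E f₁ f₂ Pa Pb (t ∸ 1) v)
           → t + 2 ≤ 3 ^ td E
lemma4 n E E-sym _ f₁ f₂ (suc j) (s≤s z≤n) Pa Pb not-stable
  with ¬∀⟶∃¬ n _ (λ v → activeAt E f₁ f₂ Pa Pb (suc j) v Bool.≟ activeAt E f₁ f₂ Pa Pb j v) not-stable
... | x , x-activated =
  subst (λ b → suc j + b ≤ 3 ^ td E) (activation⇒budget≡2 {j} {x} x-activated)
        (settles-tdAux E-sym n full (count≤n full) 0 j x refl (λ _ _ ()) (activation⇒changes {j} {x} x-activated))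
  where open Activation E f₁ f₂ Pa Pb
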